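{- Let $A=\{a_1<\ldots<a_n\}$ and $B=\{b_1<\ldots<b_m\}$ be finite sets of natural numbers, and let $k\ge 1$ be a natural number. Then there exists a subset $Z\subseteq B$ such that (1) $\left|\bigcap_{z\in Z}(A+z)\right|\ge k$, and (2) $|Z|\ge L\cdot\left(\frac{n\sqrt[k]{m}}{a_n+b_m}\right)^{k}$, where $L=\prod_{i=1}^{k-1}\frac{1-\frac{i}{n}}{1-\frac{i}{a_n+b_m}}$.
   Context: For a set $A\subseteq\mathbb{N}$ and $x\in\mathbb{N}$, $A+x=\{a+x\mid a\in A\}$. Natural numbers are the positive integers. -}

module Defs where

open import Data.Nat as ℕ using (ℕ; zero; suc; _<_; _≤_)
open import Data.Integer using (+_)
open import Data.Rational using (ℚ; 0ℚ; 1ℚ; _*_; _-_; 1/_; ≢-nonZero)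
import Data.Rational as Q
open import Data.Rational.Properties using (_≟_)
open import Data.Fin using (Fin; fromℕ)
open import Data.Fin.Subset using (Subset; _∈_)
open import Data.Product using (∃; Σ; _×_)
open import Function.Definitions using (Injective)
open import Relation.Binary.PropositionalEquality using (_≡_)
open import Relation.Nullary using (yes; no)

ℕ→ℚ : ℕ → ℚ
ℕ→ℚ n = + n Q./ 1

-- i / d as a rational; the value for d = 0 is never used in the statement
-- (the denominators occurring there, n+1 and a_n + b_m, are nonzero)
frac : ℕ → ℕ → ℚ
frac i zero    = 0ℚ
frac i (suc d) = + i Q./ suc d

pow : ℚ → ℕ → ℚ
pow q zero    = 1ℚ
pow q (suc k) = pow q k * q

inv : ℚ → ℚ
inv q with q ≟ 0ℚ
... | yes _  = 0ℚ
... | no q≢0 = 1/_ q {{≢-nonZero q≢0}}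

Lprod : ℕ → ℕ → ℕ → ℚ
Lprod n N zero    = 1ℚ
Lprod n N (suc j) = Lprod n N j * ((1ℚ - frac (suc j) n) * inv (1ℚ - frac (suc j) N))

-- A finite set {a_1 < ... < a_n} of natural numbers (positive integers),
-- given by its strictly increasing enumeration.
StrictlyIncreasing : ∀ {n} → (Fin n → ℕ) → Set
StrictlyIncreasing {n} a = ∀ {i j : Fin n} → i Data.Fin.< j → a i < a j

Positive : ∀ {n} → (Fin n → ℕ) → Set
Positive {n} a = ∀ (i : Fin n) → 1 ≤ a i

-- x ∈ ⋂_{z ∈ Z} (A + z), where Z ⊆ B is given as a subset of indices of B
InIntersection : ∀ {n m} → (Fin n → ℕ) → (Fin m → ℕ) → Subset m → ℕ → Set
InIntersection {n} {m} a b Z x = ∀ (j : Fin m) → j ∈ Z → ∃ λ (i : Fin n) → x ≡ a i ℕ.+ b j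

IntersectionCardGE : ∀ {n m} → (Fin n → ℕ) → (Fin m → ℕ) → Subset m → ℕ → Set
IntersectionCardGE a b Z k =
  Σ (Fin k → ℕ) λ f → Injective _≡_ _≡_ f × (∀ t → InIntersection a b Z (f t))

-- Put N = a_n + b_m, so that every translate A + b_z lies in {1, …, N}. Choose distinct points
-- t_1, t_2, … greedily, together with shrinking sets Z ⊆ B such that every translate A + z with
-- z ∈ Z contains all points chosen so far. When j points are chosen, each such translate has n − j
-- further points among the N − j unused ones, so by double counting some unused point lies in at
-- least |Z| (n − j) / (N − j) of them; keeping only those z gives |Z| ≥ m (n)_j / (N)_j after j
-- steps, with falling factorials (x)_j = x P′ j. Finally (n)_k / (N)_k = (n/N)^k · L, and for
-- k > n the product L vanishes, so Z = ∅ will do.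

module Submission where

open import Defs
open import Data.Nat using (ℕ; suc; _+_; _≤_; _∸_)
open import Data.Fin using (Fin; fromℕ)
open import Data.Fin.Subset using (Subset; ∣_∣)
open import Data.Product using (∃; _×_)
open import Data.Rational using (ℚ) renaming (_≤_ to _≤ℚ_; _*_ to _*ℚ_)

open import Data.Bool using (if_then_else_)
open import Data.Fin as Fin using (zero; suc; toℕ; fromℕ<; _≟_)
import Data.Fin.Properties as Fin
open import Data.Fin.Subset renaming (⊥ to ∅) using (_∈_)
open import Data.Fin.Subset.Properties using (∉⊥)
open import Data.Integer as ℤ using (+_)
import Data.Integer.Properties as ℤ
open import Data.List using (filter; allFin)
open import Data.List.Extrema.Nat using (argmax; argmax-all; f[xs]≤f[argmax])
open import Data.List.Membership.Propositional.Properties using (∈-filter⁺; ∈-allFin)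
import Data.List.Relation.Unary.All as All
open import Data.List.Relation.Unary.All.Properties using (all-filter)
open import Data.Nat as ℕ using (zero; _*_; _<_; z≤n; s≤s; _≤?_)
open import Data.Nat.Combinatorics.Base using (_P′_)
import Data.Nat.Coprimality as Coprimality
import Data.Nat.Properties as ℕ
import Data.Nat.Solver
open import Data.Product using (_,_)
open import Data.Rational as ℚ using (0ℚ; 1ℚ; mkℚ)
import Data.Rational.Properties as ℚ
import Data.Rational.Solver
open import Data.Rational.Unnormalised as ℚᵘ using (mkℚᵘ; *≡*)
import Data.Rational.Unnormalised.Properties as ℚᵘ
open import Data.Sum using (inj₁; inj₂)
open import Data.Vec using (tabulate)
import Data.Vec.Properties as Vec
open import Data.Vec.Functional using (Vector; _∷_)
open import Data.Vec.Functional.Relation.Unary.Any using (Any; any)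
open import Function using (_∘_)
open import Function.Definitions using (Injective)
open import Level using (0ℓ)
open import Relation.Binary using (tri<; tri≈; tri>)
open import Relation.Binary.PropositionalEquality
open import Relation.Nullary using (Dec; yes; no; does; ¬_; ¬?; _×-dec_; contradiction)
open import Relation.Nullary.Decidable using (dec-true; dec-false)
open import Relation.Unary using (Pred; Decidable; U)
open import Relation.Unary.Properties using (U?)

open import Algebra.Properties.Semiring.Sum ℕ.+-*-semiring
  using (sum; sum-syntax; sum-cong-≗; sum-replicate-zero; ∑-comm; ∑-distrib-+; *-distribˡ-sum; *-distribʳ-sum)

𝟙 : ∀ {ℓ} {A : Set ℓ} → Dec A → ℕ
𝟙 A? = if does A? then 1 else 0

𝟙-yes : ∀ {ℓ} {A : Set ℓ} (A? : Dec A) → A → 𝟙 A? ≡ 1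
𝟙-yes A? a = cong (λ b → if b then 1 else 0) (dec-true A? a)

𝟙-no : ∀ {ℓ} {A : Set ℓ} (A? : Dec A) → ¬ A → 𝟙 A? ≡ 0
𝟙-no A? ¬a = cong (λ b → if b then 1 else 0) (dec-false A? ¬a)

𝟙-×-dec : ∀ {a b} {A : Set a} {B : Set b} (A? : Dec A) (B? : Dec B) → 𝟙 (A? ×-dec B?) ≡ 𝟙 A? * 𝟙 B?
𝟙-×-dec (yes _) B? = sym (ℕ.+-identityʳ (𝟙 B?))
𝟙-×-dec (no _)  B? = refl

∑-mono-≤ : ∀ {n} {f g : Vector ℕ n} → (∀ i → f i ≤ g i) → sum f ≤ sum g
∑-mono-≤ {zero}  f≤g = z≤n
∑-mono-≤ {suc n} f≤g = ℕ.+-mono-≤ (f≤g zero) (∑-mono-≤ (f≤g ∘ suc))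

∑-1 : ∀ n → ∑[ i < n ] 1 ≡ n
∑-1 zero    = refl
∑-1 (suc n) = cong suc (∑-1 n)

∑-δ : ∀ {N} (s : Fin N) → ∑[ t < N ] 𝟙 (s ≟ t) ≡ 1
∑-δ {suc N} zero    = cong suc (sum-replicate-zero N)
∑-δ {suc N} (suc s) = ∑-δ s

card : ∀ {n ℓ} {P : Pred (Fin n) ℓ} → Decidable P → ℕ
card {n} P? = ∑[ i < n ] 𝟙 (P? i)

private
  m+n≡o⇒m≡o∸n : ∀ {a b c} → a + b ≡ c → a ≡ c ∸ b
  m+n≡o⇒m≡o∸n {a} {b} a+b≡c = trans (sym (ℕ.m+n∸n≡m a b)) (cong (_∸ b) a+b≡c)

card-∁ : ∀ {n ℓ} {P : Pred (Fin n) ℓ} (P? : Decidable P) → card (¬? ∘ P?) ≡ n ∸ card P?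
card-∁ {n} P? = m+n≡o⇒m≡o∸n (begin
  card (¬? ∘ P?) + card P?              ≡⟨ ∑-distrib-+ (𝟙 ∘ ¬? ∘ P?) (𝟙 ∘ P?) ⟨
  ∑[ i < n ] (𝟙 (¬? (P? i)) + 𝟙 (P? i)) ≡⟨ sum-cong-≗ (λ i → complement (P? i)) ⟩
  ∑[ i < n ] 1                          ≡⟨ ∑-1 n ⟩
  n                                     ∎)
  where
  open ≡-Reasoning
  complement : ∀ {a} {A : Set a} (A? : Dec A) → 𝟙 (¬? A?) + 𝟙 A? ≡ 1
  complement (yes _) = refl
  complement (no _)  = refl

card-∖ : ∀ {n ℓ} {P Q : Pred (Fin n) ℓ} (P? : Decidable P) (Q? : Decidable Q) → (∀ {i} → Q i → P i) →
         card (λ i → P? i ×-dec ¬? (Q? i)) ≡ card P? ∸ card Q?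
card-∖ P? Q? Q⊆P = m+n≡o⇒m≡o∸n
  (trans (sym (∑-distrib-+ (λ i → 𝟙 (P? i ×-dec ¬? (Q? i))) (𝟙 ∘ Q?))) (sum-cong-≗ pointwise))
  where
  pointwise : ∀ i → 𝟙 (P? i ×-dec ¬? (Q? i)) + 𝟙 (Q? i) ≡ 𝟙 (P? i)
  pointwise i with P? i | Q? i
  ... | yes _ | yes _ = refl
  ... | yes _ | no _  = refl
  ... | no ¬p | yes q = contradiction (Q⊆P q) ¬p
  ... | no _  | no _  = refl

card-∃ : ∀ {n ℓ} {P : Pred (Fin n) ℓ} (P? : Decidable P) → 0 < card P? → ∃ P
card-∃ {n} P? 0<card with Fin.any? P?
... | yes ∃P = ∃P
... | no ∄P = contradiction (trans (sum-cong-≗ absent) (sum-replicate-zero n)) (ℕ.>⇒≢ 0<card)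
  where
  absent : ∀ i → 𝟙 (P? i) ≡ 0
  absent i = 𝟙-no (P? i) (∄P ∘ (i ,_))

card-injective-image : ∀ {r N} {f : Fin r → Fin N} → Injective _≡_ _≡_ f → card (λ t → any (_≟ t) f) ≡ r
card-injective-image {r} {N} {f} f-inj = begin
  ∑[ t < N ] 𝟙 (any (_≟ t) f)           ≡⟨ sum-cong-≗ multiplicity ⟩
  ∑[ t < N ] ∑[ i < r ] 𝟙 (f i ≟ t)     ≡⟨ ∑-comm (λ t i → 𝟙 (f i ≟ t)) ⟩
  ∑[ i < r ] ∑[ t < N ] 𝟙 (f i ≟ t)     ≡⟨ sum-cong-≗ (∑-δ ∘ f) ⟩
  ∑[ i < r ] 1                          ≡⟨ ∑-1 r ⟩
  r                                     ∎
  where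
  open ≡-Reasoning
  multiplicity : ∀ t → 𝟙 (any (_≟ t) f) ≡ ∑[ i < r ] 𝟙 (f i ≟ t)
  multiplicity t with any (_≟ t) f
  ... | yes (i , fi≡t) = sym (trans (sum-cong-≗ only-i) (∑-δ i))
    where
    only-i : ∀ k → 𝟙 (f k ≟ t) ≡ 𝟙 (i ≟ k)
    only-i k with i ≟ k
    ... | yes refl = 𝟙-yes (f i ≟ t) fi≡t
    ... | no i≢k   = 𝟙-no (f k ≟ t) (λ fk≡t → i≢k (f-inj (trans fi≡t (sym fk≡t))))
  ... | no ∄i = sym (trans (sum-cong-≗ (λ k → 𝟙-no (f k ≟ t) (∄i ∘ (k ,_)))) (sum-replicate-zero r))

argmax-on : ∀ {N ℓ} {P : Pred (Fin N) ℓ} (P? : Decidable P) (w : Fin N → ℕ) →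
            ∃ P → ∃ λ t → P t × (∀ s → P s → w s ≤ w t)
argmax-on {N} {P = P} P? w (t₀ , Pt₀) = t , argmax-all w Pt₀ (all-filter P? (allFin N)) , maximal
  where
  candidates = filter P? (allFin N)
  t = argmax w t₀ candidates
  maximal : ∀ s → P s → w s ≤ w t
  maximal s Ps = All.lookup (f[xs]≤f[argmax] t₀ candidates) (∈-filter⁺ P? (∈-allFin s) Ps)

∃-≥-average : ∀ {N ℓ} {P : Pred (Fin N) ℓ} (P? : Decidable P) (w : Fin N → ℕ) →
              ∃ P → ∃ λ t → P t × ∑[ s < N ] (w s * 𝟙 (P? s)) ≤ w t * card P?
∃-≥-average {N} P? w ∃P with argmax-on P? w ∃P
... | t , Pt , maximal = t , Pt , (begin
  ∑[ s < N ] (w s * 𝟙 (P? s))  ≤⟨ ∑-mono-≤ bounded ⟩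
  ∑[ s < N ] (w t * 𝟙 (P? s))  ≡⟨ *-distribˡ-sum (w t) (𝟙 ∘ P?) ⟨
  w t * card P?              ∎)
  where
  open ℕ.≤-Reasoning
  bounded : ∀ s → w s * 𝟙 (P? s) ≤ w t * 𝟙 (P? s)
  bounded s with P? s
  ... | yes Ps = ℕ.*-monoˡ-≤ 1 (maximal s Ps)
  ... | no _   = ℕ.≤-reflexive (trans (ℕ.*-zeroʳ (w s)) (sym (ℕ.*-zeroʳ (w t))))

∣tabulate∣≡card : ∀ {n ℓ} {P : Pred (Fin n) ℓ} (P? : Decidable P) → ∣ tabulate (does ∘ P?) ∣ ≡ card P?
∣tabulate∣≡card {zero}  P? = refl
∣tabulate∣≡card {suc n} P? with P? zero
... | yes _ = cong suc (∣tabulate∣≡card (P? ∘ suc))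
... | no _  = ∣tabulate∣≡card (P? ∘ suc)

∈-tabulate⁻ : ∀ {n ℓ} {P : Pred (Fin n) ℓ} (P? : Decidable P) {i} → i ∈ tabulate (does ∘ P?) → P i
∈-tabulate⁻ P? {i} i∈ with P? i | trans (sym (Vec.lookup∘tabulate (does ∘ P?) i)) (Vec.[]=⇒lookup i∈)
... | yes Pi | _ = Pi

∷-injective : ∀ {A : Set} {r} {t : A} {f : Vector A r} → ¬ Any (_≡ t) f → Injective _≡_ _≡_ f →
              Injective _≡_ _≡_ (t ∷ f)
∷-injective t∉f f-inj {zero}  {zero}  _  = refl
∷-injective t∉f f-inj {zero}  {suc k} eq = contradiction (k , sym eq) t∉f
∷-injective t∉f f-inj {suc i} {zero}  eq = contradiction (i , eq) t∉f
∷-injective t∉f f-inj {suc i} {suc k} eq = cong suc (f-inj eq)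

module CommonPoints {m n N} (S : Fin m → Fin n → Fin N) (S-injective : ∀ z → Injective _≡_ _≡_ (S z))
                    (n≤N : n ≤ N) where

  large-step : ∀ j z z′ → m * (n P′ j) ≤ z * (N P′ j) → z * (n ∸ j) ≤ z′ * (N ∸ j) →
               m * (n P′ suc j) ≤ z′ * (N P′ suc j)
  large-step j z z′ before growth = begin
    m * ((n ∸ j) * (n P′ j))    ≡⟨ solve 3 (λ m a p → m :* (a :* p) := a :* (m :* p)) refl m (n ∸ j) (n P′ j) ⟩
    (n ∸ j) * (m * (n P′ j))    ≤⟨ ℕ.*-monoʳ-≤ (n ∸ j) before ⟩
    (n ∸ j) * (z * (N P′ j))    ≡⟨ solve 3 (λ a z q → a :* (z :* q) := (z :* a) :* q) refl (n ∸ j) z (N P′ j) ⟩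
    z * (n ∸ j) * (N P′ j)      ≤⟨ ℕ.*-monoˡ-≤ (N P′ j) growth ⟩
    z′ * (N ∸ j) * (N P′ j)     ≡⟨ ℕ.*-assoc z′ (N ∸ j) (N P′ j) ⟩
    z′ * ((N ∸ j) * (N P′ j))   ∎
    where
    open ℕ.≤-Reasoning
    open Data.Nat.Solver.+-*-Solver

  record Configuration (j : ℕ) : Set₁ where
    field
      points    : Fin j → Fin N
      injective : Injective _≡_ _≡_ points
      Chosen    : Pred (Fin m) 0ℓ
      chosen?   : Decidable Chosen
      shared    : ∀ {z} → Chosen z → ∀ i → Any (_≡ points i) (S z)
      large     : m * (n P′ j) ≤ card chosen? * (N P′ j)

  initial : Configuration 0
  initial = record
    { points    = λ ()
    ; injective = λ { {()} }
    ; Chosen    = U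
    ; chosen?   = U?
    ; shared    = λ _ ()
    ; large     = ℕ.≤-reflexive (cong (_* 1) (sym (∑-1 m)))
    }

  step : ∀ {j} → j < n → Configuration j → Configuration (suc j)
  step {j} j<n c = let (t , t-free , t-above-average) = ∃-≥-average free? hits free-point in record
    { points    = t ∷ points
    ; injective = ∷-injective t-free injective
    ; Chosen    = λ z → Chosen z × Any (_≡ t) (S z)
    ; chosen?   = λ z → chosen? z ×-dec any (_≟ t) (S z)
    ; shared    = λ { (_ , t∈Sz) zero → t∈Sz ; (z∈Z , _) (suc i) → shared z∈Z i }
    ; large     = large-step j (card chosen?) (hits t) large (begin
        card chosen? * (n ∸ j)               ≡⟨ double-count ⟨
        ∑[ s < N ] (hits s * 𝟙 (free? s))    ≤⟨ t-above-average ⟩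
        hits t * card free?                  ≡⟨ cong (hits t *_) free-count ⟩
        hits t * (N ∸ j)                     ∎)
    }
    where
    open Configuration c
    open ℕ.≤-Reasoning

    free? : Decidable λ s → ¬ Any (_≡ s) points
    free? s = ¬? (any (_≟ s) points)

    hits : Fin N → ℕ
    hits s = card λ z → chosen? z ×-dec any (_≟ s) (S z)

    free-count : card free? ≡ N ∸ j
    free-count = trans (card-∁ (λ s → any (_≟ s) points)) (cong (N ∸_) (card-injective-image injective))

    remaining : ∀ z → Chosen z → card (λ s → any (_≟ s) (S z) ×-dec free? s) ≡ n ∸ j
    remaining z z∈Z =
      trans (card-∖ (λ s → any (_≟ s) (S z)) (λ s → any (_≟ s) points) (λ { (i , refl) → shared z∈Z i }))
            (cong₂ _∸_ (card-injective-image (S-injective z)) (card-injective-image injective))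

    double-count : ∑[ s < N ] (hits s * 𝟙 (free? s)) ≡ card chosen? * (n ∸ j)
    double-count = begin-equality
      ∑[ s < N ] (hits s * 𝟙 (free? s))
        ≡⟨ sum-cong-≗ (λ s → *-distribʳ-sum (𝟙 (free? s)) (λ z → 𝟙 (chosen? z ×-dec any (_≟ s) (S z)))) ⟩
      ∑[ s < N ] ∑[ z < m ] (𝟙 (chosen? z ×-dec any (_≟ s) (S z)) * 𝟙 (free? s))
        ≡⟨ sum-cong-≗ (λ s → sum-cong-≗ (λ z → 𝟙-×-dec (chosen? z ×-dec any (_≟ s) (S z)) (free? s))) ⟨
      ∑[ s < N ] ∑[ z < m ] 𝟙 ((chosen? z ×-dec any (_≟ s) (S z)) ×-dec free? s)
        ≡⟨ ∑-comm (λ s z → 𝟙 ((chosen? z ×-dec any (_≟ s) (S z)) ×-dec free? s)) ⟩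
      ∑[ z < m ] ∑[ s < N ] 𝟙 ((chosen? z ×-dec any (_≟ s) (S z)) ×-dec free? s)
        ≡⟨ sum-cong-≗ per-block ⟩
      ∑[ z < m ] (𝟙 (chosen? z) * (n ∸ j))
        ≡⟨ *-distribʳ-sum (n ∸ j) (𝟙 ∘ chosen?) ⟨
      card chosen? * (n ∸ j) ∎
      where
      per-block : ∀ z → ∑[ s < N ] 𝟙 ((chosen? z ×-dec any (_≟ s) (S z)) ×-dec free? s) ≡ 𝟙 (chosen? z) * (n ∸ j)
      per-block z with chosen? z
      ... | yes z∈Z = trans (remaining z z∈Z) (sym (ℕ.+-identityʳ (n ∸ j)))
      ... | no _    = sum-replicate-zero N

    free-point : ∃ λ s → ¬ Any (_≡ s) points
    free-point = card-∃ free? (subst (0 <_) (sym free-count) (ℕ.m<n⇒0<n∸m (ℕ.<-≤-trans j<n n≤N)))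

  configuration : ∀ j → j ≤ n → Configuration j
  configuration zero    _   = initial
  configuration (suc j) j<n = step j<n (configuration j (ℕ.<⇒≤ j<n))

ℕ→ℚ≡mkℚ : ∀ x → ℕ→ℚ x ≡ mkℚ (+ x) 0 (Coprimality.sym (Coprimality.1-coprimeTo x))
ℕ→ℚ≡mkℚ x = ℚ.normalize-coprime (Coprimality.sym (Coprimality.1-coprimeTo x))

ℕ→ℚ-+ : ∀ x y → ℕ→ℚ (x + y) ≡ ℕ→ℚ x ℚ.+ ℕ→ℚ y
ℕ→ℚ-+ x y rewrite ℕ→ℚ≡mkℚ x | ℕ→ℚ≡mkℚ y =
  ℚ./-cong {+ (x + y)} (sym (cong₂ ℤ._+_ (ℤ.*-identityʳ (+ x)) (ℤ.*-identityʳ (+ y)))) refl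

ℕ→ℚ-* : ∀ x y → ℕ→ℚ (x * y) ≡ ℕ→ℚ x ℚ.* ℕ→ℚ y
ℕ→ℚ-* x y rewrite ℕ→ℚ≡mkℚ x | ℕ→ℚ≡mkℚ y = ℚ./-cong (ℤ.pos-* x y) refl

ℕ→ℚ-mono-≤ : ∀ {x y} → x ≤ y → ℕ→ℚ x ℚ.≤ ℕ→ℚ y
ℕ→ℚ-mono-≤ {x} {y} x≤y rewrite ℕ→ℚ≡mkℚ x | ℕ→ℚ≡mkℚ y =
  ℚ.*≤* (subst₂ ℤ._≤_ (sym (ℤ.*-identityʳ (+ x))) (sym (ℤ.*-identityʳ (+ y))) (ℤ.+≤+ x≤y))

ℕ→ℚ-positive : ∀ d → ℚ.Positive (ℕ→ℚ (suc d))
ℕ→ℚ-positive d rewrite ℕ→ℚ≡mkℚ (suc d) = _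

ℕ→ℚ-suc≢0 : ∀ d → ℕ→ℚ (suc d) ≢ 0ℚ
ℕ→ℚ-suc≢0 d = ℚ.<⇒≢ (ℚ.positive⁻¹ (ℕ→ℚ (suc d)) {{ℕ→ℚ-positive d}}) ∘ sym

ℕ→ℚ-cancelʳ-≤ : ∀ {p q} d → 0 < d → p ℚ.* ℕ→ℚ d ℚ.≤ q ℚ.* ℕ→ℚ d → p ℚ.≤ q
ℕ→ℚ-cancelʳ-≤ (suc d) _ = ℚ.*-cancelʳ-≤-pos (ℕ→ℚ (suc d)) {{ℕ→ℚ-positive d}}

toℚᵘ-frac : ∀ i d → ℚ.toℚᵘ (frac i (suc d)) ℚᵘ.≃ mkℚᵘ (+ i) d
toℚᵘ-frac i d = ℚ.toℚᵘ-fromℚᵘ (mkℚᵘ (+ i) d)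

frac-*-denominator : ∀ i d → frac i (suc d) ℚ.* ℕ→ℚ (suc d) ≡ ℕ→ℚ i
frac-*-denominator i d = ℚ.toℚᵘ-injective (begin
  ℚ.toℚᵘ (frac i (suc d) ℚ.* ℕ→ℚ (suc d))           ≈⟨ ℚ.toℚᵘ-homo-* (frac i (suc d)) (ℕ→ℚ (suc d)) ⟩
  ℚ.toℚᵘ (frac i (suc d)) ℚᵘ.* ℚ.toℚᵘ (ℕ→ℚ (suc d)) ≈⟨ ℚᵘ.*-cong (toℚᵘ-frac i d) (toℚᵘ-frac (suc d) 0) ⟩
  mkℚᵘ (+ i) d ℚᵘ.* mkℚᵘ (+ suc d) 0                 ≈⟨ *≡* cross-multiplied ⟩
  mkℚᵘ (+ i) 0                                       ≈⟨ toℚᵘ-frac i 0 ⟨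
  ℚ.toℚᵘ (ℕ→ℚ i)                                     ∎)
  where
  open ℚᵘ.≃-Reasoning
  cross-multiplied : (+ i ℤ.* + suc d) ℤ.* + 1 ≡ + i ℤ.* + suc (d * 1)
  cross-multiplied = trans (ℤ.*-identityʳ _) (cong (λ e → + i ℤ.* + suc e) (sym (ℕ.*-identityʳ d)))

frac-self : ∀ d → frac (suc d) (suc d) ≡ 1ℚ
frac-self d = ℚ.toℚᵘ-injective (ℚᵘ.≃-trans (toℚᵘ-frac (suc d) d) (*≡* (ℤ.*-comm (+ suc d) (+ 1))))

1-frac-*-denominator : ∀ {i d} → i ≤ suc d → (1ℚ ℚ.- frac i (suc d)) ℚ.* ℕ→ℚ (suc d) ≡ ℕ→ℚ (suc d ∸ i)
1-frac-*-denominator {i} {d} i≤D = begin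
  (1ℚ ℚ.- f) ℚ.* D            ≡⟨ solve 2 (λ f D → (con 1ℚ :- f) :* D := D :- f :* D) refl f D ⟩
  D ℚ.- f ℚ.* D               ≡⟨ cong₂ ℚ._-_ D≡r+i (frac-*-denominator i d) ⟩
  (r ℚ.+ ℕ→ℚ i) ℚ.- ℕ→ℚ i     ≡⟨ solve 2 (λ r x → (r :+ x) :- x := r) refl r (ℕ→ℚ i) ⟩
  r                           ∎
  where
  f = frac i (suc d)
  D = ℕ→ℚ (suc d)
  r = ℕ→ℚ (suc d ∸ i)
  D≡r+i : D ≡ r ℚ.+ ℕ→ℚ i
  D≡r+i = trans (cong ℕ→ℚ (sym (ℕ.m∸n+n≡m i≤D))) (ℕ→ℚ-+ (suc d ∸ i) i)
  open ≡-Reasoning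
  open Data.Rational.Solver.+-*-Solver

1-frac≢0 : ∀ {i d} → i ≤ d → 1ℚ ℚ.- frac i (suc d) ≢ 0ℚ
1-frac≢0 {i} {d} i≤d eq = ℕ→ℚ-suc≢0 (d ∸ i) (begin
  ℕ→ℚ (suc (d ∸ i))                         ≡⟨ cong ℕ→ℚ (ℕ.+-∸-assoc 1 i≤d) ⟨
  ℕ→ℚ (suc d ∸ i)                           ≡⟨ 1-frac-*-denominator (ℕ.m≤n⇒m≤1+n i≤d) ⟨
  (1ℚ ℚ.- frac i (suc d)) ℚ.* ℕ→ℚ (suc d)   ≡⟨ cong (ℚ._* ℕ→ℚ (suc d)) eq ⟩
  0ℚ ℚ.* ℕ→ℚ (suc d)                        ≡⟨ ℚ.*-zeroˡ (ℕ→ℚ (suc d)) ⟩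
  0ℚ                                        ∎)
  where open ≡-Reasoning

inv-*ˡ : ∀ q → q ≢ 0ℚ → inv q ℚ.* q ≡ 1ℚ
inv-*ˡ q q≢0 with q ℚ.≟ 0ℚ
... | yes q≡0 = contradiction q≡0 q≢0
... | no  q≢0 = ℚ.*-inverseˡ q {{ℚ.≢-nonZero q≢0}}

Lfactor : ℕ → ℕ → ℕ → ℚ
Lfactor n N i = (1ℚ ℚ.- frac i n) ℚ.* inv (1ℚ ℚ.- frac i N)

Lfactor-self : ∀ n N → Lfactor (suc n) N (suc n) ≡ 0ℚ
Lfactor-self n N = begin
  (1ℚ ℚ.- frac (suc n) (suc n)) ℚ.* w  ≡⟨ cong (λ x → (1ℚ ℚ.- x) ℚ.* w) (frac-self n) ⟩
  (1ℚ ℚ.- 1ℚ) ℚ.* w                    ≡⟨ cong (ℚ._* w) (ℚ.+-inverseʳ 1ℚ) ⟩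
  0ℚ ℚ.* w                             ≡⟨ ℚ.*-zeroˡ w ⟩
  0ℚ                                   ∎
  where
  w = inv (1ℚ ℚ.- frac (suc n) N)
  open ≡-Reasoning

-- Writing u = 1 - i/n and v = 1 - i/N, the left side is u (n/N) (v N) / v = u n = n - i.
Lfactor-*-ratio : ∀ {i n N} → i < suc n → suc n ≤ suc N →
  Lfactor (suc n) (suc N) i ℚ.* frac (suc n) (suc N) ℚ.* ℕ→ℚ (suc N ∸ i) ≡ ℕ→ℚ (suc n ∸ i)
Lfactor-*-ratio {i} {n} {N} (s≤s i≤n) (s≤s n≤N) = begin
  u ℚ.* inv v ℚ.* f ℚ.* ℕ→ℚ (suc N ∸ i)   ≡⟨ cong (u ℚ.* inv v ℚ.* f ℚ.*_) (1-frac-*-denominator (ℕ.m≤n⇒m≤1+n i≤N)) ⟨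
  u ℚ.* inv v ℚ.* f ℚ.* (v ℚ.* D)         ≡⟨ solve 5 (λ u w f v D → u :* w :* f :* (v :* D) := u :* (f :* D) :* (w :* v))
                                               refl u (inv v) f v D ⟩
  u ℚ.* (f ℚ.* D) ℚ.* (inv v ℚ.* v)       ≡⟨ cong₂ (λ x y → u ℚ.* x ℚ.* y) (frac-*-denominator (suc n) N)
                                               (inv-*ˡ v (1-frac≢0 i≤N)) ⟩
  u ℚ.* ℕ→ℚ (suc n) ℚ.* 1ℚ               ≡⟨ ℚ.*-identityʳ (u ℚ.* ℕ→ℚ (suc n)) ⟩
  u ℚ.* ℕ→ℚ (suc n)                       ≡⟨ 1-frac-*-denominator (ℕ.m≤n⇒m≤1+n i≤n) ⟩
  ℕ→ℚ (suc n ∸ i)                         ∎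
  where
  u = 1ℚ ℚ.- frac i (suc n)
  v = 1ℚ ℚ.- frac i (suc N)
  f = frac (suc n) (suc N)
  D = ℕ→ℚ (suc N)
  i≤N = ℕ.≤-trans i≤n n≤N
  open ≡-Reasoning
  open Data.Rational.Solver.+-*-Solver

Lprod-*-falling : ∀ {n N} j → suc j ≤ suc n → suc n ≤ suc N →
  Lprod (suc n) (suc N) j ℚ.* pow (frac (suc n) (suc N)) (suc j) ℚ.* ℕ→ℚ (suc N P′ suc j)
    ≡ ℕ→ℚ (suc n P′ suc j)
Lprod-*-falling {n} {N} zero _ _ = begin
  1ℚ ℚ.* (1ℚ ℚ.* f) ℚ.* ℕ→ℚ (suc N * 1)   ≡⟨ cong (λ x → 1ℚ ℚ.* (1ℚ ℚ.* f) ℚ.* ℕ→ℚ x) (ℕ.*-identityʳ (suc N)) ⟩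
  1ℚ ℚ.* (1ℚ ℚ.* f) ℚ.* ℕ→ℚ (suc N)       ≡⟨ solve 2 (λ f D → con 1ℚ :* (con 1ℚ :* f) :* D := f :* D) refl f (ℕ→ℚ (suc N)) ⟩
  f ℚ.* ℕ→ℚ (suc N)                       ≡⟨ frac-*-denominator (suc n) N ⟩
  ℕ→ℚ (suc n)                             ≡⟨ cong ℕ→ℚ (ℕ.*-identityʳ (suc n)) ⟨
  ℕ→ℚ (suc n * 1)                         ∎
  where
  f = frac (suc n) (suc N)
  open ≡-Reasoning
  open Data.Rational.Solver.+-*-Solver
Lprod-*-falling {n} {N} (suc j) j<n n≤N = begin
  L ℚ.* r ℚ.* (p ℚ.* f) ℚ.* ℕ→ℚ ((suc N ∸ suc j) * NP)
      ≡⟨ cong (L ℚ.* r ℚ.* (p ℚ.* f) ℚ.*_) (ℕ→ℚ-* (suc N ∸ suc j) NP) ⟩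
  L ℚ.* r ℚ.* (p ℚ.* f) ℚ.* (ℕ→ℚ (suc N ∸ suc j) ℚ.* ℕ→ℚ NP)
      ≡⟨ solve 6 (λ L r p f d P → L :* r :* (p :* f) :* (d :* P) := (L :* p :* P) :* (r :* f :* d))
           refl L r p f (ℕ→ℚ (suc N ∸ suc j)) (ℕ→ℚ NP) ⟩
  (L ℚ.* p ℚ.* ℕ→ℚ NP) ℚ.* (r ℚ.* f ℚ.* ℕ→ℚ (suc N ∸ suc j))
      ≡⟨ cong₂ ℚ._*_ (Lprod-*-falling j (ℕ.<⇒≤ j<n) n≤N) (Lfactor-*-ratio j<n n≤N) ⟩
  ℕ→ℚ nP ℚ.* ℕ→ℚ (suc n ∸ suc j)
      ≡⟨ ℚ.*-comm (ℕ→ℚ nP) (ℕ→ℚ (suc n ∸ suc j)) ⟩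
  ℕ→ℚ (suc n ∸ suc j) ℚ.* ℕ→ℚ nP
      ≡⟨ ℕ→ℚ-* (suc n ∸ suc j) nP ⟨
  ℕ→ℚ ((suc n ∸ suc j) * nP)
      ∎
  where
  L = Lprod (suc n) (suc N) j
  r = Lfactor (suc n) (suc N) (suc j)
  f = frac (suc n) (suc N)
  p = pow f (suc j)
  nP = suc n P′ suc j
  NP = suc N P′ suc j
  open ≡-Reasoning
  open Data.Rational.Solver.+-*-Solver

Lprod-vanishes : ∀ {n N} j → suc n ≤ j → Lprod (suc n) N j ≡ 0ℚ
Lprod-vanishes {n} {N} (suc j) n<j with ℕ.m≤n⇒m<n∨m≡n (ℕ.s≤s⁻¹ n<j)
... | inj₁ n<j′ = trans (cong (ℚ._* Lfactor (suc n) N (suc j)) (Lprod-vanishes j n<j′))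
                        (ℚ.*-zeroˡ (Lfactor (suc n) N (suc j)))
... | inj₂ refl = trans (cong (Lprod (suc n) N n ℚ.*_) (Lfactor-self n N)) (ℚ.*-zeroʳ (Lprod (suc n) N n))

P′-positive : ∀ {N k} → k ≤ N → 0 < N P′ k
P′-positive {k = zero}  _   = ℕ.0<1+n
P′-positive {k = suc k} k<N = ℕ.*-mono-< (ℕ.m<n⇒0<n∸m k<N) (P′-positive (ℕ.<⇒≤ k<N))

falling-bound : ∀ {n N} m z j → suc j ≤ n → n ≤ N → m * (n P′ suc j) ≤ z * (N P′ suc j) →
  Lprod n N j ℚ.* (pow (frac n N) (suc j) ℚ.* ℕ→ℚ m) ℚ.≤ ℕ→ℚ z
falling-bound {suc n} {suc N} m z j j<n n≤N bound =
  ℕ→ℚ-cancelʳ-≤ NP (P′-positive (ℕ.≤-trans j<n n≤N)) (begin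
    L ℚ.* (p ℚ.* ℕ→ℚ m) ℚ.* ℕ→ℚ NP  ≡⟨ solve 4 (λ L p M P → L :* (p :* M) :* P := M :* (L :* p :* P))
                                          refl L p (ℕ→ℚ m) (ℕ→ℚ NP) ⟩
    ℕ→ℚ m ℚ.* (L ℚ.* p ℚ.* ℕ→ℚ NP)  ≡⟨ cong (ℕ→ℚ m ℚ.*_) (Lprod-*-falling j j<n n≤N) ⟩
    ℕ→ℚ m ℚ.* ℕ→ℚ nP                ≡⟨ ℕ→ℚ-* m nP ⟨
    ℕ→ℚ (m * nP)                    ≤⟨ ℕ→ℚ-mono-≤ bound ⟩
    ℕ→ℚ (z * NP)                    ≡⟨ ℕ→ℚ-* z NP ⟩
    ℕ→ℚ z ℚ.* ℕ→ℚ NP                ∎)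
  where
  L = Lprod (suc n) (suc N) j
  p = pow (frac (suc n) (suc N)) (suc j)
  nP = suc n P′ suc j
  NP = suc N P′ suc j
  open ℚ.≤-Reasoning
  open Data.Rational.Solver.+-*-Solver

strictlyIncreasing⇒injective : ∀ {n} {a : Fin n → ℕ} → StrictlyIncreasing a → Injective _≡_ _≡_ a
strictlyIncreasing⇒injective a↑ {i} {k} ai≡ak with Fin.<-cmp i k
... | tri< i<k _ _ = contradiction ai≡ak (ℕ.<⇒≢ (a↑ i<k))
... | tri≈ _ i≡k _ = i≡k
... | tri> _ _ k<i = contradiction (sym ai≡ak) (ℕ.<⇒≢ (a↑ k<i))

strictlyIncreasing⇒≤last : ∀ {n} {a : Fin (suc n) → ℕ} → StrictlyIncreasing a → ∀ i → a i ≤ a (fromℕ n)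
strictlyIncreasing⇒≤last {n} a↑ i with i ≟ fromℕ n
... | yes refl = ℕ.≤-refl
... | no  i≢n  = ℕ.<⇒≤ (a↑ (Fin.≤∧≢⇒< (Fin.≤fromℕ i) i≢n))

module ShiftedCopies {n m′ N} (a : Fin n → ℕ) (b : Fin (suc m′) → ℕ) (a-injective : Injective _≡_ _≡_ a)
                     (a-positive : Positive a) (bounded : ∀ i z → a i + b z ≤ N) where

  sum-nonZero : ∀ i z → ℕ.NonZero (a i + b z)
  sum-nonZero i z = ℕ.>-nonZero (ℕ.≤-trans (a-positive i) (ℕ.m≤m+n (a i) (b z)))

  -- The value a i + b z ∈ {1, …, N} is represented by a i + b z − 1 : Fin N.
  point : Fin (suc m′) → Fin n → Fin N
  point z i = fromℕ< (subst (_≤ N) (sym (ℕ.suc-pred (a i + b z) {{sum-nonZero i z}})) (bounded i z))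

  suc-toℕ-point : ∀ z i → suc (toℕ (point z i)) ≡ a i + b z
  suc-toℕ-point z i = trans (cong suc (Fin.toℕ-fromℕ< _)) (ℕ.suc-pred (a i + b z) {{sum-nonZero i z}})

  point-injective : ∀ z → Injective _≡_ _≡_ (point z)
  point-injective z {i} {k} eq = a-injective (ℕ.+-cancelʳ-≡ (b z) (a i) (a k) (begin
    a i + b z                  ≡⟨ suc-toℕ-point z i ⟨
    suc (toℕ (point z i))      ≡⟨ cong (suc ∘ toℕ) eq ⟩
    suc (toℕ (point z k))      ≡⟨ suc-toℕ-point z k ⟩
    a k + b z                  ∎))
    where open ≡-Reasoning

  n≤N : n ≤ N
  n≤N = Fin.injective⇒≤ (point-injective zero)

  open CommonPoints point point-injective n≤N

  large-intersection : ∀ k → k ≤ n →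
    ∃ λ (Z : Subset (suc m′)) → IntersectionCardGE a b Z k × suc m′ * (n P′ k) ≤ ∣ Z ∣ * (N P′ k)
  large-intersection k k≤n =
    tabulate (does ∘ chosen?) ,
    (suc ∘ toℕ ∘ points , injective ∘ Fin.toℕ-injective ∘ ℕ.suc-injective , common) ,
    subst (λ c → suc m′ * (n P′ k) ≤ c * (N P′ k)) (sym (∣tabulate∣≡card chosen?)) large
    where
    open Configuration (configuration k k≤n)
    common : ∀ t → InIntersection a b (tabulate (does ∘ chosen?)) (suc (toℕ (points t)))
    common t z z∈Z = let (i , zi≡t) = shared (∈-tabulate⁻ chosen? z∈Z) t in
      i , trans (cong (suc ∘ toℕ) (sym zi≡t)) (suc-toℕ-point z i)

lemma2p1 : (n' m' : ℕ) (a : Fin (suc n') → ℕ) (b : Fin (suc m') → ℕ)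
    → StrictlyIncreasing a → Positive a
    → StrictlyIncreasing b → Positive b
    → (k : ℕ) → 1 ≤ k
    → ∃ λ (Z : Subset (suc m'))
        → IntersectionCardGE a b Z k
        × (Lprod (suc n') (a (fromℕ n') + b (fromℕ m')) (k ∸ 1)
             *ℚ (pow (frac (suc n') (a (fromℕ n') + b (fromℕ m'))) k *ℚ ℕ→ℚ (suc m'))
           ≤ℚ ℕ→ℚ ∣ Z ∣)
lemma2p1 n′ m′ a b a↑ a-positive b↑ _ (suc j) _ with suc j ≤? suc n′
... | yes k≤n = let (Z , common , large) = large-intersection (suc j) k≤n in
  Z , common , falling-bound (suc m′) ∣ Z ∣ j k≤n n≤N large
  where
  open ShiftedCopies a b (strictlyIncreasing⇒injective a↑) a-positive
    (λ i z → ℕ.+-mono-≤ (strictlyIncreasing⇒≤last a↑ i) (strictlyIncreasing⇒≤last b↑ z))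
... | no  k≰n =
  ∅ , (toℕ , Fin.toℕ-injective , λ _ _ z∈∅ → contradiction z∈∅ ∉⊥) ,
  subst (_≤ℚ ℕ→ℚ ∣ ∅ {suc m′} ∣) (sym vanishes) (ℕ→ℚ-mono-≤ {0} {∣ ∅ {suc m′} ∣} z≤n)
  where
  N = a (fromℕ n′) + b (fromℕ m′)
  vanishes : Lprod (suc n′) N j *ℚ (pow (frac (suc n′) N) (suc j) *ℚ ℕ→ℚ (suc m′)) ≡ 0ℚ
  vanishes = trans (cong (_*ℚ q) (Lprod-vanishes j (ℕ.s≤s⁻¹ (ℕ.≰⇒> k≰n)))) (ℚ.*-zeroˡ q)
    where q = pow (frac (suc n′) N) (suc j) *ℚ ℕ→ℚ (suc m′)
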